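{- Let $n = 2k \geq 6$ be even. Let $(G_n,\sigma_n)$ be the signed graph obtained from two vertex-disjoint copies $H, H'$ of the complete graph $K_k$, with $V(H)=\{u_1,\dots,u_k\}$ and $V(H')=\{u_1',\dots,u_k'\}$, all of whose edges are positive, by adding the negative edges $u_iu_i'$ for $i \in \{1,\dots,k\}$. Then $(G_n,\sigma_n)$ is balanced, $(G_n,-\sigma_n)$ is antibalanced, and $$C(G_n,\sigma_n) = C(G_n,\mathbf{ - }) = \frac{n}{2}-2, \qquad C(G_n,-\sigma_n) = C(G_n,\mathbf{+}) = 0.$$
   Context: A signed graph $(G,\sigma)$ is a finite simple graph $G$ with a map $\sigma\colon E(G)\to\{+,-\}$ ($\{\pm\}$ viewed as a multiplicative group). $-\sigma$ is the signature with all signs reversed; $\mathbf{+}$ and $\mathbf{ - }$ denote the all-positive and all-negative signatures. Switching at $X\subseteq V(G)$ reverses the signs of all edges with exactly one end in $X$; two signatures are equivalent if one is obtained from the other by switching at some vertex set. $(G,\sigma)$ is balanced if every circuit has an even number of negative edges (equivalently, it is equivalent to $(G,\mathbf{+})$), and antibalanced if it is equivalent to $(G,\mathbf{ - })$. Information dissemination (ID) process on $(G,\sigma)$: each vertex has a state in $\{A,-A,C,0\}$, initially all $0$. In step $i\geq 1$: choose a vertex $v_i$ of state $0$ (a placement vertex) and set its state to $A$. Then, simultaneously for every vertex $v$ currently in state $0$, consider its neighbours $z$ currently in state $A$ or $-A$ (states after placing $v_i$, before this step's updates); each such $z$ sends $\sigma(vz)\cdot\mathrm{state}(z)$ (with $-(-A)=A$).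 If $v$ has no such neighbour it stays $0$; if all sent values are equal, $v$ takes that value; if two sent values differ, $v$ gets state $C$ (confused). Vertices with state $A$, $-A$ or $C$ keep their state. Repeat until no vertex has state $0$. The value of the run is the number of vertices of final state $C$. The confusion number $C(G,\sigma)$ is the minimum value over all possible runs (all choices of placement vertices). -}

module Defs where

open import Data.Bool using (Bool; true; false; if_then_else_; _∧_; not)
open import Data.Nat using (ℕ; zero; suc; _+_; _*_; _≤_)
open import Data.Fin using (Fin; splitAt; _≟_)
open import Data.Fin.Properties using ()
open import Data.List using (List; []; _∷_; _++_; zip; length; foldr; allFin)
open import Data.List.Relation.Unary.All using (All)
open import Data.List.Relation.Unary.Unique.Propositional using (Unique)
open import Data.Product using (_×_; _,_; proj₁; proj₂; ∃-syntax)
open import Data.Sum using (inj₁; inj₂)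
open import Relation.Nullary using (¬_; yes; no)
open import Relation.Nullary.Decidable using (⌊_⌋)
open import Relation.Binary.PropositionalEquality using (_≡_)

data Sign : Set where
  pos neg : Sign

_·_ : Sign → Sign → Sign
pos · s = s
neg · pos = neg
neg · neg = pos

-- Graphs on vertex set Fin n: adjacency (Boolean) and signatures.
-- A signature is given as a function on ordered pairs; only its values on
-- edges matter.

Adj : ℕ → Set
Adj n = Fin n → Fin n → Bool

Signature : ℕ → Set
Signature n = Fin n → Fin n → Sign

negSig : ∀ {n} → Signature n → Signature n
negSig σ u v = neg · σ u v

allPos : ∀ {n} → Signature n
allPos _ _ = pos

allNeg : ∀ {n} → Signature n
allNeg _ _ = neg

mark : ∀ {n} → (Fin n → Bool) → Fin n → Sign
mark X v = if X v then neg else pos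

switch : ∀ {n} → (Fin n → Bool) → Signature n → Signature n
switch X σ u v = mark X u · (σ u v · mark X v)

Equivalent : ∀ {n} → Adj n → Signature n → Signature n → Set
Equivalent {n} G σ τ =
  ∃[ X ] (∀ (u v : Fin n) → G u v ≡ true → τ u v ≡ switch X σ u v)

-- edges of the closed walk v₀ v₁ … v_{m-1} v₀
cycEdges : ∀ {n} → List (Fin n) → List (Fin n × Fin n)
cycEdges [] = []
cycEdges (v ∷ vs) = zip (v ∷ vs) (vs ++ (v ∷ []))

IsCircuit : ∀ {n} → Adj n → List (Fin n) → Set
IsCircuit G vs =
  (3 ≤ length vs) × Unique vs × All (λ e → G (proj₁ e) (proj₂ e) ≡ true) (cycEdges vs)

isNeg : Sign → ℕ
isNeg pos = 0
isNeg neg = 1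

negCount : ∀ {n} → Signature n → List (Fin n) → ℕ
negCount σ vs = foldr (λ e acc → isNeg (σ (proj₁ e) (proj₂ e)) + acc) 0 (cycEdges vs)

Balanced : ∀ {n} → Adj n → Signature n → Set
Balanced G σ = ∀ vs → IsCircuit G vs → ∃[ m ] (negCount σ vs ≡ 2 * m)

Antibalanced : ∀ {n} → Adj n → Signature n → Set
Antibalanced G σ = Equivalent G σ allNeg

data St : Set where
  A nA C O : St     -- A, -A, C (confused), 0

-- sign acting on a state (only used on A / -A)
act : Sign → St → St
act pos x = x
act neg A = nA
act neg nA = A
act neg x = x

eqSt : St → St → Bool
eqSt A A = true
eqSt nA nA = true
eqSt C C = true
eqSt O O = true
eqSt _ _ = false

isInformed : St → Bool
isInformed A = true
isInformed nA = true
isInformed _ = false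

data Recv : Set where
  none : Recv
  one  : St → Recv
  conf : Recv

addRecv : Recv → St → Recv
addRecv none s = one s
addRecv (one t) s = if eqSt t s then one t else conf
addRecv conf _ = conf

Config : ℕ → Set
Config n = Fin n → St

received : ∀ {n} → Adj n → Signature n → Config n → Fin n → Recv
received {n} G σ c w =
  foldr (λ z r → if G w z ∧ isInformed (c z) then addRecv r (act (σ w z) (c z)) else r)
        none (allFin n)

newState : St → Recv → St
newState O none = O
newState O (one s) = s
newState O conf = C
newState x _ = x

place : ∀ {n} → Config n → Fin n → Config n
place c v w with v ≟ w
... | yes _ = A
... | no  _ = c w

step : ∀ {n} → Adj n → Signature n → Config n → Fin n → Config n
step G σ c v = let c' = place c v in λ w → newState (c' w) (received G σ c' w)

initial : ∀ {n} → Config n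
initial _ = O

countC : ∀ {n} → Config n → ℕ
countC {n} c = foldr (λ v acc → (if eqSt (c v) C then 1 else 0) + acc) 0 (allFin n)

-- Outcome G σ c m : some run of the ID process from configuration c ends
-- (no vertex of state 0) with exactly m confused vertices.
data Outcome {n} (G : Adj n) (σ : Signature n) : Config n → ℕ → Set where
  done : ∀ {c} → (∀ v → ¬ (c v ≡ O)) → Outcome G σ c (countC c)
  next : ∀ {c m} (v : Fin n) → c v ≡ O → Outcome G σ (step G σ c v) m → Outcome G σ c m

ConfusionNumber : ∀ {n} → Adj n → Signature n → ℕ → Set
ConfusionNumber G σ m =
  Outcome G σ initial m × (∀ m' → Outcome G σ initial m' → m ≤ m')

-- The graph G_n (n = k + k): vertices Fin (k + k); u_i = inject i (left half),
-- u_i' = raise k i (right half).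

Gn : (k : ℕ) → Adj (k + k)
Gn k u v with splitAt k u | splitAt k v
... | inj₁ i | inj₁ j = not ⌊ i ≟ j ⌋
... | inj₂ i | inj₂ j = not ⌊ i ≟ j ⌋
... | inj₁ i | inj₂ j = ⌊ i ≟ j ⌋
... | inj₂ i | inj₁ j = ⌊ i ≟ j ⌋

σn : (k : ℕ) → Signature (k + k)
σn k u v with splitAt k u | splitAt k v
... | inj₁ _ | inj₁ _ = pos
... | inj₂ _ | inj₂ _ = pos
... | _ | _ = neg

{-# OPTIONS --safe #-}
module Submission where

-- (G_n, σ_n) is (G_n, +) switched at the copy H', hence balanced, and the same switching turns
-- (G_n, −σ_n) into (G_n, −), so it is antibalanced.
--
-- For the confusion numbers, all four signatures are constant on each copy of K_k (value a) and on
-- the matching (value b), and for every such signature all runs of the ID process have the same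
-- value. The first placement u_i informs its whole copy and its partner u_i'. The other k − 1
-- vertices of the second copy are still uninformed, so there is a second placement u_l', and it
-- ends the process: each of the remaining k − 2 vertices u_j' hears a·A from u_l' and a·b·A from
-- u_i' (and b·a·A from u_j). So all of them are confused if b = −, and none is if b = +.

open import Defs

open import Data.Bool using (Bool; true; false; if_then_else_; _∧_; not)
import Data.Bool.Properties as Bool
open import Data.Bool.Properties using (∧-conicalˡ; ∧-conicalʳ; ¬-not; not-¬)
open import Data.Fin using (Fin; zero; suc; splitAt; join; _↑ˡ_; _↑ʳ_; _≟_; punchIn; fromℕ<)
open import Data.Fin.Properties using (splitAt-↑ˡ; splitAt-↑ʳ; join-splitAt; ↑ˡ-injective; ↑ʳ-injective; punchInᵢ≢i)
open import Data.List using (List; []; _∷_; _++_; zip; foldr; tabulate; allFin)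
open import Data.List.Membership.Propositional using (_∈_)
open import Data.List.Membership.Propositional.Properties using (∈-allFin)
open import Data.List.Relation.Unary.All using (All; _∷_)
open import Data.List.Relation.Unary.Any using (here; there)
open import Data.Nat using (ℕ; zero; suc; _+_; _*_; _∸_; _≤_; s≤s; z≤n)
open import Data.Nat.Properties using (+-0-commutativeMonoid; +-comm; +-assoc; +-suc; m+n∸n≡m; ≤-reflexive; <⇒≤)
open import Data.Product using (_×_; _,_; proj₁; proj₂; ∃-syntax)
open import Data.Sum using (_⊎_; inj₁; inj₂)
open import Function using (_∘_)
open import Relation.Binary.PropositionalEquality
open import Relation.Nullary using (yes; no; does; contradiction)
open import Relation.Nullary.Decidable using (dec-true; dec-false; isYes≗does)
open import Algebra.Properties.CommutativeMonoid.Sum +-0-commutativeMonoid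
  using (sum; sum-cong-≗; ∑-distrib-+; sum-replicate-zero)

·-identityʳ : ∀ s → s · pos ≡ s
·-identityʳ pos = refl
·-identityʳ neg = refl

·-self : ∀ s → s · s ≡ pos
·-self pos = refl
·-self neg = refl

neg·-involutive : ∀ s → neg · (neg · s) ≡ s
neg·-involutive pos = refl
neg·-involutive neg = refl

·-telescope : ∀ x y z → (x · y) · (y · z) ≡ x · z
·-telescope pos pos pos = refl
·-telescope pos pos neg = refl
·-telescope pos neg pos = refl
·-telescope pos neg neg = refl
·-telescope neg pos pos = refl
·-telescope neg pos neg = refl
·-telescope neg neg pos = refl
·-telescope neg neg neg = refl

parity : ℕ → Sign
parity zero    = pos
parity (suc n) = neg · parity n

parity-isNeg-+ : ∀ s n → parity (isNeg s + n) ≡ s · parity n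
parity-isNeg-+ pos n = refl
parity-isNeg-+ neg n = refl

parity-pos⇒even : ∀ n → parity n ≡ pos → ∃[ m ] n ≡ 2 * m
parity-pos⇒even zero          _ = 0 , refl
parity-pos⇒even (suc zero)    ()
parity-pos⇒even (suc (suc n)) p with parity-pos⇒even n (trans (sym (neg·-involutive (parity n))) p)
... | m , refl = suc m , cong suc (sym (+-suc m (m + 0)))

-- Along a walk of edges, σ u v = mark X u · mark X v telescopes.
equivalent-allPos⇒balanced : ∀ {n} {G : Adj n} {σ : Signature n} →
                             Equivalent G allPos σ → Balanced G σ
equivalent-allPos⇒balanced _ [] _ = 0 , refl
equivalent-allPos⇒balanced {n} {G} {σ} (X , σ≡) (v ∷ vs) (_ , _ , edges) =
  parity-pos⇒even _ (trans (walk-parity v vs v edges) (·-self (mark X v)))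
  where
  walk : Fin n → List (Fin n) → Fin n → List (Fin n × Fin n)
  walk x ys e = zip (x ∷ ys) (ys ++ e ∷ [])

  negatives : List (Fin n × Fin n) → ℕ
  negatives = foldr (λ e acc → isNeg (σ (proj₁ e) (proj₂ e)) + acc) 0

  walk-parity : ∀ x ys e → All (λ e → G (proj₁ e) (proj₂ e) ≡ true) (walk x ys e) →
                parity (negatives (walk x ys e)) ≡ mark X x · mark X e
  walk-parity x [] e (xe ∷ _) = begin
    parity (isNeg (σ x e) + 0) ≡⟨ parity-isNeg-+ (σ x e) 0 ⟩
    σ x e · pos                ≡⟨ ·-identityʳ (σ x e) ⟩
    σ x e                      ≡⟨ σ≡ x e xe ⟩
    mark X x · mark X e        ∎
    where open ≡-Reasoning
  walk-parity x (y ∷ ys) e (xy ∷ edges) = begin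
    parity (isNeg (σ x y) + negatives (walk y ys e))  ≡⟨ parity-isNeg-+ (σ x y) _ ⟩
    σ x y · parity (negatives (walk y ys e))          ≡⟨ cong₂ _·_ (σ≡ x y xy) (walk-parity y ys e edges) ⟩
    (mark X x · mark X y) · (mark X y · mark X e)     ≡⟨ ·-telescope (mark X x) (mark X y) (mark X e) ⟩
    mark X x · mark X e                               ∎
    where open ≡-Reasoning

equivalent-allPos⇒antibalanced-negSig : ∀ {n} {G : Adj n} {σ : Signature n} →
                                        Equivalent G allPos σ → Antibalanced G (negSig σ)
equivalent-allPos⇒antibalanced-negSig {σ = σ} (X , σ≡) = X , λ u v uv → begin
  neg                                                    ≡⟨ negate-switched (mark X u) (mark X v) ⟩
  mark X u · ((neg · (mark X u · mark X v)) · mark X v)  ≡⟨ cong (λ s → mark X u · ((neg · s) · mark X v)) (σ≡ u v uv) ⟨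
  switch X (negSig σ) u v                                ∎
  where
  open ≡-Reasoning
  negate-switched : ∀ x y → neg ≡ x · ((neg · (x · y)) · y)
  negate-switched pos pos = refl
  negate-switched pos neg = refl
  negate-switched neg pos = refl
  negate-switched neg neg = refl

eqSt-refl : ∀ x → eqSt x x ≡ true
eqSt-refl A  = refl
eqSt-refl nA = refl
eqSt-refl C  = refl
eqSt-refl O  = refl

eqSt-sound : ∀ x y → eqSt x y ≡ true → x ≡ y
eqSt-sound A  A  _ = refl
eqSt-sound nA nA _ = refl
eqSt-sound C  C  _ = refl
eqSt-sound O  O  _ = refl
eqSt-sound A  nA ()
eqSt-sound A  C  ()
eqSt-sound A  O  ()
eqSt-sound nA A  ()
eqSt-sound nA C  ()
eqSt-sound nA O  ()
eqSt-sound C  A  ()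
eqSt-sound C  nA ()
eqSt-sound C  O  ()
eqSt-sound O  A  ()
eqSt-sound O  nA ()
eqSt-sound O  C  ()

Heard : St → Recv → Set
Heard x r = r ≡ one x ⊎ r ≡ conf

HeardOnly : St → Recv → Set
HeardOnly x r = r ≡ none ⊎ r ≡ one x

addRecv-heard : ∀ r y → Heard y (addRecv r y)
addRecv-heard none     y = inj₁ refl
addRecv-heard conf     y = inj₂ refl
addRecv-heard (one x)  y with eqSt x y in x≈y
... | true  = inj₁ (cong one (eqSt-sound x y x≈y))
... | false = inj₂ refl

addRecv-keeps-heard : ∀ {x r} y → Heard x r → Heard x (addRecv r y)
addRecv-keeps-heard {x} y (inj₁ refl) with eqSt x y
... | true  = inj₁ refl
... | false = inj₂ refl
addRecv-keeps-heard y (inj₂ refl) = inj₂ refl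

addRecv-heardOnly : ∀ {x r} → HeardOnly x r → addRecv r x ≡ one x
addRecv-heardOnly     (inj₁ refl) = refl
addRecv-heardOnly {x} (inj₂ refl) rewrite eqSt-refl x = refl

heard∧heardOnly⇒one : ∀ {x r} → Heard x r → HeardOnly x r → r ≡ one x
heard∧heardOnly⇒one (inj₁ r≡x) _           = r≡x
heard∧heardOnly⇒one (inj₂ refl) (inj₁ ())
heard∧heardOnly⇒one (inj₂ refl) (inj₂ ())

heard-distinct⇒conf : ∀ {x y r} → Heard x r → Heard y r → x ≢ y → r ≡ conf
heard-distinct⇒conf (inj₂ r≡conf) _             _   = r≡conf
heard-distinct⇒conf (inj₁ _)      (inj₂ r≡conf) _   = r≡conf
heard-distinct⇒conf (inj₁ refl)   (inj₁ refl)   x≢x = contradiction refl x≢x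

module Collect {I : Set} (p : I → Bool) (m : I → St) where

  collect : List I → Recv
  collect = foldr (λ z r → if p z then addRecv r (m z) else r) none

  collect-none : (∀ z → p z ≡ false) → ∀ zs → collect zs ≡ none
  collect-none silent []       = refl
  collect-none silent (z ∷ zs) rewrite silent z = collect-none silent zs

  collect-heardOnly : ∀ {x} → (∀ z → p z ≡ true → m z ≡ x) → ∀ zs → HeardOnly x (collect zs)
  collect-heardOnly sends []       = inj₁ refl
  collect-heardOnly sends (z ∷ zs) with p z | sends z
  ... | true  | z-sends = inj₂ (subst (λ y → addRecv (collect zs) y ≡ one _) (sym (z-sends refl))
                                       (addRecv-heardOnly (collect-heardOnly sends zs)))
  ... | false | _       = collect-heardOnly sends zs

  collect-heard : ∀ {z zs} → p z ≡ true → z ∈ zs → Heard (m z) (collect zs)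
  collect-heard {z} {z ∷ zs} pz (here refl) rewrite pz = addRecv-heard (collect zs) (m z)
  collect-heard {z} {y ∷ zs} pz (there z∈zs) with p y
  ... | true  = addRecv-keeps-heard (m y) (collect-heard pz z∈zs)
  ... | false = collect-heard pz z∈zs

module Reception {n} (G : Adj n) (σ : Signature n) (c : Config n) (w : Fin n) where

  message : Fin n → St
  message z = act (σ w z) (c z)

  open Collect (λ z → G w z ∧ isInformed (c z)) message

  received-none : (∀ z → G w z ≡ true → isInformed (c z) ≡ false) → received G σ c w ≡ none
  received-none uninformed = collect-none silent (allFin n)
    where
    silent : ∀ z → (G w z ∧ isInformed (c z)) ≡ false
    silent z with G w z in adj
    ... | true  = uninformed z adj
    ... | false = refl

  received-one : ∀ {x z₀} → (∀ z → G w z ≡ true → isInformed (c z) ≡ true → message z ≡ x) →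
                 G w z₀ ≡ true → isInformed (c z₀) ≡ true → received G σ c w ≡ one x
  received-one {z₀ = z₀} sends adj informed =
    heard∧heardOnly⇒one
      (subst (λ y → Heard y (collect (allFin n))) (sends z₀ adj informed)
             (collect-heard (cong₂ _∧_ adj informed) (∈-allFin z₀)))
      (collect-heardOnly (λ z pz → sends z (∧-conicalˡ _ _ pz) (∧-conicalʳ _ _ pz)) (allFin n))

  received-conf : ∀ {z₁ z₂} → G w z₁ ≡ true → isInformed (c z₁) ≡ true →
                  G w z₂ ≡ true → isInformed (c z₂) ≡ true → message z₁ ≢ message z₂ →
                  received G σ c w ≡ conf
  received-conf {z₁} {z₂} adj₁ informed₁ adj₂ informed₂ =
    heard-distinct⇒conf (collect-heard (cong₂ _∧_ adj₁ informed₁) (∈-allFin z₁))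
                        (collect-heard (cong₂ _∧_ adj₂ informed₂) (∈-allFin z₂))

open Reception using (received-none; received-one; received-conf)

informed⇒≢O : ∀ {x} → isInformed x ≡ true → x ≢ O
informed⇒≢O informed refl = contradiction informed λ ()

informed⇒≢C : ∀ {x} → isInformed x ≡ true → x ≢ C
informed⇒≢C informed refl = contradiction informed λ ()

act-A-informed : ∀ s → isInformed (act s A) ≡ true
act-A-informed pos = refl
act-A-informed neg = refl

act-nA≢act-A : ∀ s → act s nA ≢ act s A
act-nA≢act-A pos ()
act-nA≢act-A neg ()

newState-≢O : ∀ {x} r → x ≢ O → newState x r ≡ x
newState-≢O {A}  _ _   = refl
newState-≢O {nA} _ _   = refl
newState-≢O {C}  _ _   = refl
newState-≢O {O}  _ x≢O = contradiction refl x≢O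

place-self : ∀ {n} (c : Config n) v → place c v v ≡ A
place-self c v with v ≟ v
... | yes _   = refl
... | no  v≢v = contradiction refl v≢v

place-other : ∀ {n} (c : Config n) {v w} → v ≢ w → place c v w ≡ c w
place-other c {v} {w} v≢w with v ≟ w
... | yes v≡w = contradiction v≡w v≢w
... | no  _   = refl

placed-only : ∀ {n} {v z : Fin n} → isInformed (place initial v z) ≡ true → v ≡ z
placed-only {v = v} {z} informed with v ≟ z | informed
... | yes v≡z | _ = v≡z
... | no  _   | ()

module Steps {n} (G : Adj n) (σ : Signature n) where

  step-placed : ∀ (c : Config n) v → step G σ c v v ≡ A
  step-placed c v = cong (λ x → newState x (received G σ (place c v) v)) (place-self c v)

  step-keeps-informed : ∀ (c : Config n) v w → isInformed (place c v w) ≡ true →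
                        isInformed (step G σ c v w) ≡ true
  step-keeps-informed c v w informed =
    trans (cong isInformed (newState-≢O (received G σ (place c v) w) (informed⇒≢O informed))) informed

  step-uninformed : ∀ (c : Config n) v w → place c v w ≡ O →
                    step G σ c v w ≡ newState O (received G σ (place c v) w)
  step-uninformed c v w = cong (λ x → newState x (received G σ (place c v) w))

  step-initial-neighbour : ∀ {v w} → w ≢ v → G w v ≡ true → step G σ initial v w ≡ act (σ w v) A
  step-initial-neighbour {v} {w} w≢v adj =
    trans (step-uninformed initial v w (place-other initial (w≢v ∘ sym)))
          (cong (newState O) (received-one G σ (place initial v) w sends-A adj
                                           (cong isInformed (place-self initial v))))
    where
    sends-A : ∀ z → G w z ≡ true → isInformed (place initial v z) ≡ true →
              act (σ w z) (place initial v z) ≡ act (σ w v) A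
    sends-A z _ informed with placed-only {v = v} {z} informed
    ... | refl = cong (act (σ w v)) (place-self initial v)

  step-initial-nonneighbour : ∀ {v w} → w ≢ v → G w v ≡ false → step G σ initial v w ≡ O
  step-initial-nonneighbour {v} {w} w≢v nonadj =
    trans (step-uninformed initial v w (place-other initial (w≢v ∘ sym)))
          (cong (newState O) (received-none G σ (place initial v) w silent))
    where
    silent : ∀ z → G w z ≡ true → isInformed (place initial v z) ≡ false
    silent z adj with v ≟ z
    ... | yes refl = contradiction (trans (sym adj) nonadj) λ ()
    ... | no  _    = refl

  outcome-finished : ∀ {c m} → (∀ v → c v ≢ O) → Outcome G σ c m → m ≡ countC c
  outcome-finished _        (done _)         = refl
  outcome-finished finished (next v cv≡O _) = contradiction cv≡O (finished v)

confused : St → ℕ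
confused x = if eqSt x C then 1 else 0

confused-≢C : ∀ {x} → x ≢ C → confused x ≡ 0
confused-≢C {A}  _   = refl
confused-≢C {nA} _   = refl
confused-≢C {C}  x≢C = contradiction refl x≢C
confused-≢C {O}  _   = refl

countC≡sum : ∀ {n} (c : Config n) → countC c ≡ sum (confused ∘ c)
countC≡sum {n} c = go (λ v → v)
  where
  go : ∀ {m} (g : Fin m → Fin n) →
       foldr (λ v acc → confused (c v) + acc) 0 (tabulate g) ≡ sum (confused ∘ c ∘ g)
  go {zero}  g = refl
  go {suc m} g = cong (confused (c (g zero)) +_) (go (g ∘ suc))

sum-zero : ∀ {n} {f : Fin n → ℕ} → (∀ j → f j ≡ 0) → sum f ≡ 0
sum-zero {n} f≡0 = trans (sum-cong-≗ f≡0) (sum-replicate-zero n)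

sum-ones : ∀ n → sum {n} (λ _ → 1) ≡ n
sum-ones zero    = refl
sum-ones (suc n) = cong suc (sum-ones n)

sum-split : ∀ m {n} (f : Fin (m + n) → ℕ) →
            sum f ≡ sum (λ i → f (i ↑ˡ n)) + sum (λ j → f (m ↑ʳ j))
sum-split zero    f = refl
sum-split (suc m) f = trans (cong (f zero +_) (sum-split m (f ∘ suc))) (sym (+-assoc (f zero) _ _))

indicator : ∀ {n} → Fin n → Fin n → ℕ
indicator x j = if does (j ≟ x) then 1 else 0

sum-indicator : ∀ {n} (x : Fin n) → sum (indicator x) ≡ 1
sum-indicator {suc n} zero = cong suc (sum-zero {n} λ _ → refl)
sum-indicator {suc n} (suc x) = sum-indicator {n} x

sum-except-two : ∀ {n} {f : Fin n → ℕ} {x y} → x ≢ y → f x ≡ 0 → f y ≡ 0 →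
                 (∀ j → j ≢ x → j ≢ y → f j ≡ 1) → sum f ≡ n ∸ 2
sum-except-two {n} {f} {x} {y} x≢y fx≡0 fy≡0 f≡1 = begin
  sum f                                                     ≡⟨ m+n∸n≡m (sum f) 2 ⟨
  sum f + 2 ∸ 2                                             ≡⟨ cong (λ t → sum f + t ∸ 2) indicators ⟩
  sum f + (sum (indicator x) + sum (indicator y)) ∸ 2       ≡⟨ cong (_∸ 2) distrib ⟨
  sum (λ j → f j + (indicator x j + indicator y j)) ∸ 2     ≡⟨ cong (_∸ 2) (trans (sum-cong-≗ pointwise) (sum-ones n)) ⟩
  n ∸ 2                                                     ∎
  where
  open ≡-Reasoning
  indicators : 2 ≡ sum (indicator x) + sum (indicator y)
  indicators = sym (cong₂ _+_ (sum-indicator x) (sum-indicator y))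
  distrib : sum (λ j → f j + (indicator x j + indicator y j)) ≡ sum f + (sum (indicator x) + sum (indicator y))
  distrib = trans (∑-distrib-+ f _) (cong (sum f +_) (∑-distrib-+ (indicator x) (indicator y)))
  pointwise : ∀ j → f j + (indicator x j + indicator y j) ≡ 1
  pointwise j with j ≟ x | j ≟ y
  ... | yes refl | yes refl = contradiction refl x≢y
  ... | yes refl | no  _    = cong (_+ 1) fx≡0
  ... | no  _    | yes refl = cong (_+ 1) fy≡0
  ... | no  j≢x  | no  j≢y  = trans (+-comm (f j) 0) (f≡1 j j≢x j≢y)

-- Side false is H (vertices u_i), side true is H' (vertices u_i').
vertex : ∀ k → Bool → Fin k → Fin (k + k)
vertex k false i = i ↑ˡ k
vertex k true  i = k ↑ʳ i

data Coordinates (k : ℕ) : Fin (k + k) → Set where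
  at : ∀ s i → Coordinates k (vertex k s i)

coordinates : ∀ k v → Coordinates k v
coordinates k v = subst (Coordinates k) (join-splitAt k k v) (of-split (splitAt k v))
  where
  of-split : ∀ x → Coordinates k (join k k x)
  of-split (inj₁ i) = at false i
  of-split (inj₂ i) = at true i

vertex-injective : ∀ {k s t} {i j : Fin k} → vertex k s i ≡ vertex k t j → s ≡ t × i ≡ j
vertex-injective {k} {false} {false} {i} {j} eq = refl , ↑ˡ-injective k i j eq
vertex-injective {k} {true}  {true}  {i} {j} eq = refl , ↑ʳ-injective k i j eq
vertex-injective {k} {false} {true}  {i} {j} eq
  with () ← trans (sym (splitAt-↑ˡ k i k)) (trans (cong (splitAt k) eq) (splitAt-↑ʳ k k j))
vertex-injective {k} {true}  {false} {i} {j} eq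
  with () ← trans (sym (splitAt-↑ʳ k k i)) (trans (cong (splitAt k) eq) (splitAt-↑ˡ k j k))

side≢⇒vertex≢ : ∀ {k s t} → s ≢ t → (i j : Fin k) → vertex k s i ≢ vertex k t j
side≢⇒vertex≢ {s = s} {t} s≢t i j = s≢t ∘ proj₁ ∘ vertex-injective {s = s} {t}

index≢⇒vertex≢ : ∀ {k} s t {i j : Fin k} → i ≢ j → vertex k s i ≢ vertex k t j
index≢⇒vertex≢ s t i≢j = i≢j ∘ proj₂ ∘ vertex-injective {s = s} {t}

Gn-same : ∀ {k} s (i j : Fin k) → Gn k (vertex k s i) (vertex k s j) ≡ not (does (i ≟ j))
Gn-same {k} false i j rewrite splitAt-↑ˡ k i k | splitAt-↑ˡ k j k = cong not (isYes≗does (i ≟ j))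
Gn-same {k} true  i j rewrite splitAt-↑ʳ k k i | splitAt-↑ʳ k k j = cong not (isYes≗does (i ≟ j))

Gn-cross : ∀ {k s t} → s ≢ t → (i j : Fin k) → Gn k (vertex k s i) (vertex k t j) ≡ does (i ≟ j)
Gn-cross {k} {false} {true}  _ i j rewrite splitAt-↑ˡ k i k | splitAt-↑ʳ k k j = isYes≗does (i ≟ j)
Gn-cross {k} {true}  {false} _ i j rewrite splitAt-↑ʳ k k i | splitAt-↑ˡ k j k = isYes≗does (i ≟ j)
Gn-cross {s = false} {false} s≢t = contradiction refl s≢t
Gn-cross {s = true}  {true}  s≢t = contradiction refl s≢t

adjacent-same : ∀ {k} s {i j : Fin k} → i ≢ j → Gn k (vertex k s i) (vertex k s j) ≡ true
adjacent-same s {i} {j} i≢j = trans (Gn-same s i j) (cong not (dec-false (i ≟ j) i≢j))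

adjacent-cross : ∀ {k s t} → s ≢ t → (i : Fin k) → Gn k (vertex k s i) (vertex k t i) ≡ true
adjacent-cross s≢t i = trans (Gn-cross s≢t i i) (dec-true (i ≟ i) refl)

nonadjacent-cross : ∀ {k s t} {i j : Fin k} → s ≢ t → i ≢ j → Gn k (vertex k s i) (vertex k t j) ≡ false
nonadjacent-cross {i = i} {j} s≢t i≢j = trans (Gn-cross s≢t i j) (dec-false (i ≟ j) i≢j)

side : ∀ k → Fin (k + k) → Bool
side k v with splitAt k v
... | inj₁ _ = false
... | inj₂ _ = true

σn-equivalent : ∀ k → Equivalent (Gn k) allPos (σn k)
σn-equivalent k = side k , λ u v _ → switched u v
  where
  switched : ∀ u v → σn k u v ≡ switch (side k) allPos u v
  switched u v with splitAt k u | splitAt k v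
  ... | inj₁ _ | inj₁ _ = refl
  ... | inj₁ _ | inj₂ _ = refl
  ... | inj₂ _ | inj₁ _ = refl
  ... | inj₂ _ | inj₂ _ = refl

record SideUniform (k : ℕ) (σ : Signature (k + k)) (a b : Sign) : Set where
  field
    same  : ∀ s (i j : Fin k) → σ (vertex k s i) (vertex k s j) ≡ a
    cross : ∀ {s t} → s ≢ t → (i j : Fin k) → σ (vertex k s i) (vertex k t j) ≡ b

σn-sideUniform : ∀ k → SideUniform k (σn k) pos neg
σn-sideUniform k = record { same = same ; cross = cross }
  where
  same : ∀ s (i j : Fin k) → σn k (vertex k s i) (vertex k s j) ≡ pos
  same false i j rewrite splitAt-↑ˡ k i k | splitAt-↑ˡ k j k = refl
  same true  i j rewrite splitAt-↑ʳ k k i | splitAt-↑ʳ k k j = refl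
  cross : ∀ {s t} → s ≢ t → (i j : Fin k) → σn k (vertex k s i) (vertex k t j) ≡ neg
  cross {false} {true}  _ i j rewrite splitAt-↑ˡ k i k | splitAt-↑ʳ k k j = refl
  cross {true}  {false} _ i j rewrite splitAt-↑ʳ k k i | splitAt-↑ˡ k j k = refl
  cross {false} {false} s≢t = contradiction refl s≢t
  cross {true}  {true}  s≢t = contradiction refl s≢t

negSig-sideUniform : ∀ {k σ a b} → SideUniform k σ a b → SideUniform k (negSig σ) (neg · a) (neg · b)
negSig-sideUniform uniform = record
  { same  = λ s i j → cong (neg ·_) (same s i j)
  ; cross = λ s≢t i j → cong (neg ·_) (cross s≢t i j)
  }
  where open SideUniform uniform

allPos-sideUniform : ∀ {k} → SideUniform k allPos pos pos
allPos-sideUniform = record { same = λ _ _ _ → refl ; cross = λ _ _ _ → refl }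

allNeg-sideUniform : ∀ {k} → SideUniform k allNeg neg neg
allNeg-sideUniform = record { same = λ _ _ _ → refl ; cross = λ _ _ _ → refl }

sum-by-side : ∀ {k s t} → s ≢ t → (f : Fin (k + k) → ℕ) →
              sum f ≡ sum (f ∘ vertex k s) + sum (f ∘ vertex k t)
sum-by-side {k} {false} {true}  _ f = sum-split k f
sum-by-side {k} {true}  {false} _ f = trans (sum-split k f) (+-comm (sum (f ∘ vertex k false)) _)
sum-by-side {s = false} {false} s≢t = contradiction refl s≢t
sum-by-side {s = true}  {true}  s≢t = contradiction refl s≢t

other-index : ∀ {k} → 2 ≤ k → (i : Fin k) → ∃[ j ] j ≢ i
other-index (s≤s (s≤s z≤n)) i = punchIn i zero , punchInᵢ≢i i zero

other-side : ∀ {s t t′ : Bool} → t ≢ s → t′ ≢ s → t′ ≡ t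
other-side t≢s t′≢s = trans (¬-not t′≢s) (sym (¬-not t≢s))

farConfusion : ℕ → Sign → ℕ
farConfusion k pos = 0
farConfusion k neg = k ∸ 2

module Dissemination {k} {σ : Signature (k + k)} {a b : Sign} (uniform : SideUniform k σ a b) where

  open SideUniform uniform
  open Steps (Gn k) σ

  farState : Sign → St
  farState pos = act a A
  farState neg = C

  farState-≢O : ∀ b′ → farState b′ ≢ O
  farState-≢O pos = informed⇒≢O (act-A-informed a)
  farState-≢O neg = λ ()

  module FirstPlacement (s : Bool) (i : Fin k) where

    c₁ : Config (k + k)
    c₁ = step (Gn k) σ initial (vertex k s i)

    c₁-placed : c₁ (vertex k s i) ≡ A
    c₁-placed = step-placed initial (vertex k s i)

    c₁-near : ∀ {j} → j ≢ i → c₁ (vertex k s j) ≡ act a A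
    c₁-near {j} j≢i = trans (step-initial-neighbour (index≢⇒vertex≢ s s j≢i) (adjacent-same s j≢i))
                            (cong (λ x → act x A) (same s j i))

    c₁-partner : ∀ {t} → t ≢ s → c₁ (vertex k t i) ≡ act b A
    c₁-partner t≢s = trans (step-initial-neighbour (side≢⇒vertex≢ t≢s i i) (adjacent-cross t≢s i))
                           (cong (λ x → act x A) (cross t≢s i i))

    c₁-far : ∀ {t j} → t ≢ s → j ≢ i → c₁ (vertex k t j) ≡ O
    c₁-far {j = j} t≢s j≢i =
      step-initial-nonneighbour (side≢⇒vertex≢ t≢s j i) (nonadjacent-cross t≢s j≢i)

    c₁-near-informed : ∀ j → isInformed (c₁ (vertex k s j)) ≡ true
    c₁-near-informed j with j ≟ i
    ... | yes refl = cong isInformed c₁-placed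
    ... | no  j≢i  = trans (cong isInformed (c₁-near j≢i)) (act-A-informed a)

    c₁-uninformed : ∀ {t j} → c₁ (vertex k t j) ≡ O → t ≢ s × j ≢ i
    c₁-uninformed {t} {j} uninformed with t Bool.≟ s | j ≟ i
    ... | yes refl | _        = contradiction uninformed (informed⇒≢O (c₁-near-informed j))
    ... | no  t≢s  | yes refl = contradiction (trans (sym (c₁-partner t≢s)) uninformed)
                                             (informed⇒≢O (act-A-informed b))
    ... | no  t≢s  | no  j≢i  = t≢s , j≢i

  module SecondPlacement (s : Bool) (i : Fin k) {t i₂} (t≢s : t ≢ s) (i₂≢i : i₂ ≢ i) where

    open FirstPlacement s i

    v₂ : Fin (k + k)
    v₂ = vertex k t i₂

    c₁′ : Config (k + k)
    c₁′ = place c₁ v₂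

    c₂ : Config (k + k)
    c₂ = step (Gn k) σ c₁ v₂

    c₁′-near-informed : ∀ j → isInformed (c₁′ (vertex k s j)) ≡ true
    c₁′-near-informed j = trans (cong isInformed (place-other c₁ (side≢⇒vertex≢ t≢s i₂ j)))
                                (c₁-near-informed j)

    c₁′-near : ∀ {j} → j ≢ i → c₁′ (vertex k s j) ≡ act a A
    c₁′-near {j} j≢i = trans (place-other c₁ (side≢⇒vertex≢ t≢s i₂ j)) (c₁-near j≢i)

    c₁′-partner : c₁′ (vertex k t i) ≡ act b A
    c₁′-partner = trans (place-other c₁ (index≢⇒vertex≢ t t i₂≢i)) (c₁-partner t≢s)

    c₁′-partner-informed : isInformed (c₁′ (vertex k t i)) ≡ true
    c₁′-partner-informed = trans (cong isInformed c₁′-partner) (act-A-informed b)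

    c₁′-placed : c₁′ v₂ ≡ A
    c₁′-placed = place-self c₁ v₂

    c₁′-far : ∀ {j} → j ≢ i → j ≢ i₂ → c₁′ (vertex k t j) ≡ O
    c₁′-far j≢i j≢i₂ = trans (place-other c₁ (index≢⇒vertex≢ t t (j≢i₂ ∘ sym))) (c₁-far t≢s j≢i)

    far-messages : ∀ {j} → b ≡ pos → j ≢ i → ∀ z → Gn k (vertex k t j) z ≡ true →
                   isInformed (c₁′ z) ≡ true → act (σ (vertex k t j) z) (c₁′ z) ≡ act a A
    far-messages {j} b≡pos j≢i z adj informed with coordinates k z
    ... | at t′ j′ with t′ Bool.≟ s
    ... | yes refl with j′ ≟ j
    ... | yes refl = cong₂ act (trans (cross t≢s j j) b≡pos) (c₁′-near j≢i)
    ... | no  j′≢j = contradiction (trans (sym adj) (nonadjacent-cross t≢s (j′≢j ∘ sym))) λ ()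
    far-messages {j} b≡pos j≢i z adj informed | at t′ j′ | no t′≢s with other-side t≢s t′≢s
    ... | refl with j′ ≟ i₂ | j′ ≟ i
    ... | yes refl | _        = cong₂ act (same t j i₂) c₁′-placed
    ... | no  _    | yes refl = cong₂ act (same t j i) (trans c₁′-partner (cong (λ x → act x A) b≡pos))
    ... | no  j′≢i₂ | no j′≢i =
      contradiction (trans (sym informed) (cong isInformed (c₁′-far j′≢i j′≢i₂))) λ ()

    c₂-far : ∀ {j} → j ≢ i → j ≢ i₂ → c₂ (vertex k t j) ≡ farState b
    c₂-far {j} j≢i j≢i₂ = trans (step-uninformed c₁ v₂ w (c₁′-far j≢i j≢i₂)) (hears b refl)
      where
      w : Fin (k + k)
      w = vertex k t j

      hears : ∀ b′ → b ≡ b′ → newState O (received (Gn k) σ c₁′ w) ≡ farState b′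
      hears pos b≡pos = cong (newState O)
        (received-one (Gn k) σ c₁′ w (far-messages b≡pos j≢i)
                                     (adjacent-same t j≢i₂) (cong isInformed c₁′-placed))
      hears neg b≡neg = cong (newState O)
        (received-conf (Gn k) σ c₁′ w (adjacent-same t j≢i) c₁′-partner-informed
                                      (adjacent-same t j≢i₂) (cong isInformed c₁′-placed) distinct)
        where
        distinct : act (σ w (vertex k t i)) (c₁′ (vertex k t i)) ≢ act (σ w v₂) (c₁′ v₂)
        distinct rewrite same t j i | same t j i₂ | c₁′-partner | c₁′-placed | b≡neg = act-nA≢act-A a

    c₂-cases : ∀ w → isInformed (c₂ w) ≡ true ⊎ c₂ w ≡ farState b
    c₂-cases w with coordinates k w
    ... | at t′ j with t′ Bool.≟ s
    ... | yes refl = inj₁ (step-keeps-informed c₁ v₂ (vertex k s j) (c₁′-near-informed j))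
    ... | no t′≢s with other-side t≢s t′≢s
    ... | refl with j ≟ i | j ≟ i₂
    ... | yes refl | _        = inj₁ (step-keeps-informed c₁ v₂ (vertex k t i) c₁′-partner-informed)
    ... | no  _    | yes refl = inj₁ (cong isInformed (step-placed c₁ v₂))
    ... | no  j≢i  | no  j≢i₂ = inj₂ (c₂-far j≢i j≢i₂)

    c₂-finished : ∀ w → c₂ w ≢ O
    c₂-finished w with c₂-cases w
    ... | inj₁ informed = informed⇒≢O informed
    ... | inj₂ far      = farState-≢O b ∘ trans (sym far)

    c₂-count : countC c₂ ≡ farConfusion k b
    c₂-count = count b refl
      where
      count : ∀ b′ → b ≡ b′ → countC c₂ ≡ farConfusion k b′
      count pos b≡pos = trans (countC≡sum c₂) (sum-zero (confused-≢C ∘ unconfused))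
        where
        unconfused : ∀ w → c₂ w ≢ C
        unconfused w with c₂-cases w
        ... | inj₁ informed = informed⇒≢C informed
        ... | inj₂ far      =
          informed⇒≢C (act-A-informed a) ∘ trans (sym (trans far (cong farState b≡pos)))
      count neg b≡neg = begin
        countC c₂                                                  ≡⟨ countC≡sum c₂ ⟩
        sum (confused ∘ c₂)                                        ≡⟨ sum-by-side {k} (t≢s ∘ sym) (confused ∘ c₂) ⟩
        sum (confused ∘ c₂ ∘ vertex k s)
          + sum (confused ∘ c₂ ∘ vertex k t)                       ≡⟨ cong₂ _+_ near far ⟩
        0 + (k ∸ 2)                                                ∎
        where
        open ≡-Reasoning
        near : sum (confused ∘ c₂ ∘ vertex k s) ≡ 0
        near = sum-zero λ j →
          confused-≢C (informed⇒≢C (step-keeps-informed c₁ v₂ (vertex k s j) (c₁′-near-informed j)))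
        far : sum (confused ∘ c₂ ∘ vertex k t) ≡ k ∸ 2
        far = sum-except-two (i₂≢i ∘ sym)
          (confused-≢C (informed⇒≢C (step-keeps-informed c₁ v₂ (vertex k t i) c₁′-partner-informed)))
          (cong confused (step-placed c₁ v₂))
          (λ j j≢i j≢i₂ → cong confused (trans (c₂-far j≢i j≢i₂) (cong farState b≡neg)))

  every-run : ∀ {m} → 2 ≤ k → Outcome (Gn k) σ initial m → m ≡ farConfusion k b
  every-run 2≤k (done unfinished) = contradiction refl (unfinished (vertex k false (fromℕ< 2≤k)))
  every-run 2≤k (next v₁ _ run) with coordinates k v₁
  ... | at s i = after-first run
    where
    open FirstPlacement s i
    after-first : ∀ {m} → Outcome (Gn k) σ c₁ m → m ≡ farConfusion k b
    after-first (done unfinished) =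
      contradiction (c₁-far {not s} (≢-sym (not-¬ refl)) (proj₂ (other-index 2≤k i))) (unfinished _)
    after-first (next v₂ uninformed run) with coordinates k v₂
    ... | at t i₂ with c₁-uninformed {t} {i₂} uninformed
    ... | t≢s , i₂≢i = trans (outcome-finished c₂-finished run) c₂-count
      where open SecondPlacement s i t≢s i₂≢i

  some-run : 2 ≤ k → Outcome (Gn k) σ initial (farConfusion k b)
  some-run 2≤k = subst (Outcome (Gn k) σ initial) c₂-count
    (next (vertex k false i₀) refl (next v₂ (c₁-far {true} (λ ()) j₀≢i₀) (done c₂-finished)))
    where
    i₀ : Fin k
    i₀ = fromℕ< 2≤k
    j₀ : Fin k
    j₀ = proj₁ (other-index 2≤k i₀)
    j₀≢i₀ : j₀ ≢ i₀
    j₀≢i₀ = proj₂ (other-index 2≤k i₀)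
    open FirstPlacement false i₀
    open SecondPlacement false i₀ {true} (λ ()) j₀≢i₀

  confusionNumber : 2 ≤ k → ConfusionNumber (Gn k) σ (farConfusion k b)
  confusionNumber 2≤k = some-run 2≤k , λ m run → ≤-reflexive (sym (every-run 2≤k run))

open Dissemination using (confusionNumber)

proposition2p2 : (k : ℕ) → 3 ≤ k →
    Balanced (Gn k) (σn k)
    × Antibalanced (Gn k) (negSig (σn k))
    × ConfusionNumber (Gn k) (σn k) (k ∸ 2)
    × ConfusionNumber (Gn k) allNeg (k ∸ 2)
    × ConfusionNumber (Gn k) (negSig (σn k)) 0
    × ConfusionNumber (Gn k) allPos 0
proposition2p2 k 3≤k =
    equivalent-allPos⇒balanced (σn-equivalent k)
  , equivalent-allPos⇒antibalanced-negSig (σn-equivalent k)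
  , confusionNumber (σn-sideUniform k) 2≤k
  , confusionNumber allNeg-sideUniform 2≤k
  , confusionNumber (negSig-sideUniform (σn-sideUniform k)) 2≤k
  , confusionNumber allPos-sideUniform 2≤k
  where
  2≤k : 2 ≤ k
  2≤k = <⇒≤ 3≤k
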